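{- Let $G$ be a distance-transitive graph of order $n$. If $G$ is $k$-fixed, then for each $v\in V(G)$, $\deg_{D(G)}(v)=\binom{n}{2}-\sum_{i=1}^{e(v)}\binom{|\Psi_i(v)|}{2}$.
   Context: Graphs are finite, simple, connected, with nontrivial automorphism group $\mathrm{Aut}(G)$. $G$ is distance-transitive if for all $u,v,x,y\in V(G)$ with $d(u,v)=d(x,y)$ there is $g\in\mathrm{Aut}(G)$ with $g(u)=x$, $g(v)=y$. For $S\subseteq V(G)$, $\mathrm{stab}(S)=\{g\in \mathrm{Aut}(G): g(w)=w \text{ for all } w\in S\}$; $S$ is a fixing set if $\mathrm{stab}(S)$ is trivial. $\mathrm{fix}(G)$ is the minimum size of a fixing set, $\mathrm{fxd}(G)$ the minimum $k$ such that every $k$-subset of $V(G)$ is fixing; $G$ is $k$-fixed if both equal $k$. $e(v)$ is the eccentricity of $v$ and $\Psi_i(v)=\{x\in V(G): d(v,x)=i\}$. Vertices are similar if an automorphism maps one to the other; $S(G)$ is the set of vertices similar to some other vertex, and $V_s(G)$ the set of unordered pairs of distinct similar vertices. The fixing graph $D(G)$ is the bipartite graph with parts $S(G)$ and $V_s(G)$ in which $v\in S(G)$ is adjacent to $(x,y)\in V_s(G)$ iff no $g\in\mathrm{stab}(\{v\})$ satisfies $g(x)=y$. -}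

module Defs where

open import Data.Nat using (ℕ; zero; suc; _+_; _∸_; _⊔_; _<_)
open import Data.Nat.Combinatorics using (_C_)
open import Data.Bool using (Bool; true; false; if_then_else_; _∨_; _∧_)
open import Data.Fin using (Fin; toℕ)
open import Data.Fin.Subset using (Subset; _∈_; ∣_∣)
open import Data.List using (List; map; foldr; upTo; allFin; length)
open import Data.Nat.ListAction using (sum)
open import Data.Bool.ListAction using (any)
open import Data.List.Relation.Unary.Unique.Propositional using (Unique)
import Data.List.Membership.Propositional as LM
open import Data.Product using (Σ; ∃; _×_; _,_; proj₁; proj₂)
open import Function.Bundles using (_⇔_)
open import Function.Definitions using (Bijective)
open import Relation.Binary.PropositionalEquality using (_≡_; _≢_)
open import Relation.Nullary using (¬_)
open import Data.Nat using (_≡ᵇ_)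

record Graph (n : ℕ) : Set where
  field
    adj     : Fin n → Fin n → Bool
    symm    : ∀ x y → adj x y ≡ adj y x
    irrefl  : ∀ x → adj x x ≡ false

module _ {n : ℕ} (G : Graph n) where
  open Graph G

  eqF : Fin n → Fin n → Bool
  eqF x y = toℕ x ≡ᵇ toℕ y

  reach : ℕ → Fin n → Fin n → Bool
  reach zero    u v = eqF u v
  reach (suc k) u v = reach k u v ∨ any (λ w → adj u w ∧ reach k w v) (allFin n)

  Connected : Set
  Connected = ∀ u v → ∃ λ k → reach k u v ≡ true

  -- least k ≤ b with f k = true (b if none)
  leastUpTo : (ℕ → Bool) → ℕ → ℕ
  leastUpTo f zero    = zero
  leastUpTo f (suc b) = if f zero then zero else suc (leastUpTo (λ k → f (suc k)) b)

  -- shortest-path distance (for connected graphs, d(u,v) ≤ n - 1 < n)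
  dist : Fin n → Fin n → ℕ
  dist u v = leastUpTo (λ k → reach k u v) n

  ecc : Fin n → ℕ
  ecc v = foldr _⊔_ 0 (map (dist v) (allFin n))

  psiSize : Fin n → ℕ → ℕ
  psiSize v i = sum (map (λ x → if dist v x ≡ᵇ i then 1 else 0) (allFin n))

  IsAut : (Fin n → Fin n) → Set
  IsAut g = Bijective _≡_ _≡_ g × (∀ x y → adj (g x) (g y) ≡ adj x y)

  NontrivialAut : Set
  NontrivialAut = ∃ λ g → IsAut g × ∃ λ x → g x ≢ x

  DistanceTransitive : Set
  DistanceTransitive = ∀ u v x y → dist u v ≡ dist x y →
    ∃ λ g → IsAut g × g u ≡ x × g v ≡ y

  Fixing : Subset n → Set
  Fixing S = ∀ g → IsAut g → (∀ w → w ∈ S → g w ≡ w) → ∀ x → g x ≡ x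

IsMin : (ℕ → Set) → ℕ → Set
IsMin P k = P k × (∀ j → j < k → ¬ P j)

module _ {n : ℕ} (G : Graph n) where

  FixNumber : ℕ → Set
  FixNumber = IsMin (λ j → ∃ λ (S : Subset n) → ∣ S ∣ ≡ j × Fixing G S)

  FixedNumber : ℕ → Set
  FixedNumber = IsMin (λ j → ∀ (S : Subset n) → ∣ S ∣ ≡ j → Fixing G S)

  KFixed : ℕ → Set
  KFixed k = FixNumber k × FixedNumber k

  Similar : Fin n → Fin n → Set
  Similar x y = ∃ λ g → IsAut G g × g x ≡ y

  -- unordered pair {x,y} (represented with toℕ x < toℕ y) is adjacent to v
  -- in the fixing graph D(G): {x,y} ∈ V_s(G) and no g ∈ stab({v}) maps x to y
  DAdj : Fin n → Fin n × Fin n → Set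
  DAdj v (x , y) = toℕ x < toℕ y × Similar x y ×
    ¬ (∃ λ g → IsAut G g × g v ≡ v × g x ≡ y)

Card : {A : Set} → (A → Set) → ℕ → Set
Card {A} P c = ∃ λ (xs : List A) → Unique xs × (∀ a → (a LM.∈ xs) ⇔ P a) × length xs ≡ c

-- In a distance-transitive graph any two vertices x, y are similar (as d(x,x) = d(y,y)), and an
-- automorphism fixing v maps x to y exactly when d(v,x) = d(v,y). So the neighbours of v in D(G)
-- are the pairs of vertices in different distance layers Ψ_i(v): all C(n,2) pairs except the
-- C(|Ψ_i(v)|,2) pairs inside each layer, where Ψ_0(v) = {v} contributes nothing.

module Submission where

open import Data.Bool using (Bool; true; false; T; if_then_else_; _∨_; _∧_)
open import Data.Bool.Properties using (⇔→≡; T-≡)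
open import Data.Bool.ListAction using (any)
open import Data.Fin using (Fin; toℕ) renaming (zero to fzero; suc to fsuc)
import Data.Fin.Properties as Fin
open import Data.List using (List; []; _∷_; _++_; map; filter; length; upTo; allFin; foldr)
open import Data.List.Properties
  using (map-tabulate; map-cong; length-map; length-++; length-tabulate; foldr-preservesᵒ)
open import Data.List.Membership.Propositional using (_∈_; _∉_; find; lose)
open import Data.List.Membership.Propositional.Properties
  using (∈-allFin; ∈-map⁺; ∈-map⁻; ∈-++⁺ˡ; ∈-++⁺ʳ; ∈-++⁻; ∈-filter⁺; ∈-filter⁻; ∈-upTo⁺)
open import Data.List.Relation.Unary.All using (universal)
open import Data.List.Relation.Unary.All.Properties using (All¬⇒¬Any)
import Data.List.Relation.Unary.All.Properties as All
open import Data.List.Relation.Unary.Any using (here; there)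
import Data.List.Relation.Unary.Any.Properties as Any
open import Data.List.Relation.Unary.AllPairs using ([]; _∷_)
open import Data.List.Relation.Unary.Unique.Propositional using (Unique)
import Data.List.Relation.Unary.Unique.Propositional.Properties as Unique
open import Data.Nat using (ℕ; zero; suc; _+_; _∸_; _≤_; _<_; _⊔_; _≡ᵇ_; z≤n; s≤s; z<s; s<s; _≟_)
open import Data.Nat.Properties
open import Algebra.Properties.CommutativeSemigroup +-commutativeSemigroup using (interchange)
open import Data.Nat.Combinatorics using (_C_; nC1≡n; nCk+nC[k+1]≡[n+1]C[k+1]; k>n⇒nCk≡0)
open import Data.Nat.ListAction using (sum)
open import Data.Product using (∃; _×_; _,_; proj₁; proj₂)
import Data.Product as Product
open import Data.Sum using (inj₁; inj₂; [_,_])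
open import Function using (_∘_; id)
open import Function.Bundles using (_⇔_; mk⇔; Equivalence)
open import Function.Definitions using (Surjective)
import Function.Properties.Equivalence as ⇔
open import Relation.Binary.PropositionalEquality
  using (_≡_; _≢_; refl; sym; trans; cong; cong₂; subst; ≢-sym; module ≡-Reasoning)
open import Relation.Nullary using (¬_; does; yes; no; _because_)
open import Relation.Nullary.Decidable using (dec-true; dec-false)
open import Relation.Unary using (Pred; Decidable)
open import Relation.Unary.Properties using (∁?)

open import Defs

open Equivalence using (to; from)

T-injective : ∀ {a b} → T a ⇔ T b → a ≡ b
T-injective Ta⇔Tb = ⇔→≡ {z = true} (⇔.trans (⇔.sym T-≡) (⇔.trans Ta⇔Tb T-≡))

sum-map-+ : ∀ {A : Set} (g h : A → ℕ) xs →
  sum (map (λ x → g x + h x) xs) ≡ sum (map g xs) + sum (map h xs)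
sum-map-+ g h [] = refl
sum-map-+ g h (x ∷ xs) =
  trans (cong (g x + h x +_) (sum-map-+ g h xs)) (interchange (g x) (h x) _ _)

sum-map-allFin-suc : ∀ {n} (h : Fin (suc n) → ℕ) →
  sum (map h (allFin (suc n))) ≡ h fzero + sum (map (h ∘ fsuc) (allFin n))
sum-map-allFin-suc h = cong (λ xs → h fzero + sum xs)
  (trans (map-tabulate fsuc h) (sym (map-tabulate id (h ∘ fsuc))))

module _ {a p} {A : Set a} {P : Pred A p} (P? : Decidable P) where

  length-filter-∁ : ∀ xs →
    length (filter (∁? P?) xs) + sum (map (λ x → if does (P? x) then 1 else 0) xs) ≡ length xs
  length-filter-∁ [] = refl
  length-filter-∁ (x ∷ xs) with P? x
  ... | true because _ = trans (+-suc _ _) (cong suc (length-filter-∁ xs))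
  ... | false because _ = cong suc (length-filter-∁ xs)

-- does (m ≟ n) is definitionally m ≡ᵇ n.
≡⇒≡ᵇ-true : ∀ {m n} → m ≡ n → (m ≡ᵇ n) ≡ true
≡⇒≡ᵇ-true = dec-true (_ ≟ _)

≢⇒≡ᵇ-false : ∀ {m n} → m ≢ n → (m ≡ᵇ n) ≡ false
≢⇒≡ᵇ-false = dec-false (_ ≟ _)

module _ (g : ℕ → ℕ) (a : ℕ) where

  select : ℕ → ℕ
  select i = if a ≡ᵇ i then g i else 0

  sum-select-∉ : ∀ {is} → a ∉ is → sum (map select is) ≡ 0
  sum-select-∉ {[]} _ = refl
  sum-select-∉ {i ∷ is} a∉ rewrite ≢⇒≡ᵇ-false (a∉ ∘ here) = sum-select-∉ (a∉ ∘ there)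

  sum-select : ∀ {is} → Unique is → a ∈ is → sum (map select is) ≡ g a
  sum-select (a∉is ∷ _) (here refl) rewrite ≡⇒≡ᵇ-true (refl {x = a}) =
    trans (cong (g a +_) (sum-select-∉ (All¬⇒¬Any a∉is))) (+-identityʳ (g a))
  sum-select {i ∷ _} (i∉is ∷ is-unique) (there a∈is)
    rewrite ≢⇒≡ᵇ-false {a} {i} (λ { refl → All¬⇒¬Any i∉is a∈is }) = sum-select is-unique a∈is

suc-C-2 : ∀ m → m + m C 2 ≡ suc m C 2
suc-C-2 m = trans (cong (_+ m C 2) (sym (nC1≡n m))) (nCk+nC[k+1]≡[n+1]C[k+1] m 1)

insert-C-2 : ∀ b m → ((if b then 1 else 0) + m) C 2 ≡ (if b then m else 0) + m C 2
insert-C-2 true m = sym (suc-C-2 m)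
insert-C-2 false m = refl

≤1⇒C-2≡0 : ∀ {m} → m ≤ 1 → m C 2 ≡ 0
≤1⇒C-2≡0 m≤1 = k>n⇒nCk≡0 (s≤s m≤1)

fibre : ∀ {n} → (Fin n → ℕ) → ℕ → ℕ
fibre {n} f i = sum (map (λ x → if f x ≡ᵇ i then 1 else 0) (allFin n))

fibre-suc : ∀ {n} (f : Fin (suc n) → ℕ) i →
  fibre f i ≡ (if f fzero ≡ᵇ i then 1 else 0) + fibre (f ∘ fsuc) i
fibre-suc f i = sum-map-allFin-suc (λ x → if f x ≡ᵇ i then 1 else 0)

fibre-≡0 : ∀ {n} {f : Fin n → ℕ} {i} → (∀ x → f x ≢ i) → fibre f i ≡ 0
fibre-≡0 {zero} _ = refl
fibre-≡0 {suc n} {f} {i} f≢i rewrite fibre-suc f i | ≢⇒≡ᵇ-false (f≢i fzero) =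
  fibre-≡0 (f≢i ∘ fsuc)

fibre-≤1 : ∀ {n} {f : Fin n → ℕ} {i} → (∀ {x y} → f x ≡ i → f y ≡ i → x ≡ y) → fibre f i ≤ 1
fibre-≤1 {zero} _ = z≤n
fibre-≤1 {suc n} {f} {i} f-injective rewrite fibre-suc f i with f fzero ≟ i
... | yes f0≡i rewrite ≡⇒≡ᵇ-true f0≡i =
  s≤s (≤-reflexive (fibre-≡0 {f = f ∘ fsuc} (λ x fx≡i → Fin.0≢1+n (f-injective f0≡i fx≡i))))
... | no f0≢i rewrite ≢⇒≡ᵇ-false f0≢i =
  fibre-≤1 (λ fx≡i fy≡i → Fin.suc-injective (f-injective fx≡i fy≡i))

Separated : ∀ {n} → (Fin n → ℕ) → Fin n × Fin n → Set
Separated f (x , y) = toℕ x < toℕ y × f x ≢ f y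

separatedFromZero : ∀ {n} → (Fin (suc n) → ℕ) → List (Fin n)
separatedFromZero {n} f = filter (∁? (λ y → f (fsuc y) ≟ f fzero)) (allFin n)

separatedPairs : ∀ {n} → (Fin n → ℕ) → List (Fin n × Fin n)
separatedPairs {zero} f = []
separatedPairs {suc n} f =
  map (λ y → fzero , fsuc y) (separatedFromZero f) ++
  map (Product.map fsuc fsuc) (separatedPairs (f ∘ fsuc))

∈-separatedPairs⁻ : ∀ {n} (f : Fin n → ℕ) {p} → p ∈ separatedPairs f → Separated f p
∈-separatedPairs⁻ {suc n} f p∈ with ∈-++⁻ (map (λ y → fzero , fsuc y) (separatedFromZero f)) p∈
... | inj₁ p∈row with y , y∈ , refl ← ∈-map⁻ _ p∈row =
  z<s , ≢-sym (proj₂ (∈-filter⁻ (∁? (λ y → f (fsuc y) ≟ f fzero)) {xs = allFin n} y∈))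
... | inj₂ p∈rest with (x , y) , xy∈ , refl ← ∈-map⁻ _ p∈rest =
  Product.map₁ s<s (∈-separatedPairs⁻ (f ∘ fsuc) xy∈)

∈-separatedPairs⁺ : ∀ {n} (f : Fin n → ℕ) {p} → Separated f p → p ∈ separatedPairs f
∈-separatedPairs⁺ {suc n} f {fzero , fsuc y} (_ , f0≢fy) =
  ∈-++⁺ˡ (∈-map⁺ _ (∈-filter⁺ (∁? (λ y → f (fsuc y) ≟ f fzero)) (∈-allFin y) (≢-sym f0≢fy)))
∈-separatedPairs⁺ {suc n} f {fsuc x , fsuc y} (s<s x<y , fx≢fy) =
  ∈-++⁺ʳ _ (∈-map⁺ _ (∈-separatedPairs⁺ (f ∘ fsuc) (x<y , fx≢fy)))

∈-separatedPairs : ∀ {n} (f : Fin n → ℕ) {p} → p ∈ separatedPairs f ⇔ Separated f p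
∈-separatedPairs f = mk⇔ (∈-separatedPairs⁻ f) (∈-separatedPairs⁺ f)

separatedPairs-unique : ∀ {n} (f : Fin n → ℕ) → Unique (separatedPairs f)
separatedPairs-unique {zero} f = []
separatedPairs-unique {suc n} f = Unique.++⁺
  (Unique.map⁺ (λ { refl → refl }) (Unique.filter⁺ _ (Unique.allFin⁺ n)))
  (Unique.map⁺ (λ { {_ , _} {_ , _} refl → refl }) (separatedPairs-unique (f ∘ fsuc)))
  λ (p∈row , p∈rest) → distinct-heads (∈-map⁻ _ p∈row) (∈-map⁻ _ p∈rest)
  where
  distinct-heads : ∀ {p : Fin (suc n) × Fin (suc n)} →
    (∃ λ y → y ∈ separatedFromZero f × p ≡ (fzero , fsuc y)) →
    (∃ λ q → q ∈ separatedPairs (f ∘ fsuc) × p ≡ Product.map fsuc fsuc q) → _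
  distinct-heads (_ , _ , refl) (_ , _ , ())

length-separatedFromZero : ∀ {n} (f : Fin (suc n) → ℕ) →
  length (separatedFromZero f) + fibre (f ∘ fsuc) (f fzero) ≡ n
length-separatedFromZero {n} f =
  trans (length-filter-∁ (λ y → f (fsuc y) ≟ f fzero) (allFin n)) (length-tabulate id)

length-separatedPairs : ∀ {n} (f : Fin n → ℕ) {is} → Unique is → (∀ x → f x ∈ is) →
  length (separatedPairs f) + sum (map (λ i → fibre f i C 2) is) ≡ n C 2
length-separatedPairs {zero} f {is} _ _ = sum-zeros is
  where
  sum-zeros : ∀ is → sum (map (λ i → fibre f i C 2) is) ≡ 0
  sum-zeros [] = refl
  sum-zeros (_ ∷ is) = sum-zeros is
length-separatedPairs {suc n} f {is} is-unique f∈is = begin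
  length (row ++ map (Product.map fsuc fsuc) (separatedPairs f')) + pairsWithin f
    ≡⟨ cong₂ _+_ length-split pairsWithin-split ⟩
  (length (separatedFromZero f) + length (separatedPairs f')) + (fibre f' a + pairsWithin f')
    ≡⟨ interchange (length (separatedFromZero f)) _ (fibre f' a) _ ⟩
  (length (separatedFromZero f) + fibre f' a) + (length (separatedPairs f') + pairsWithin f')
    ≡⟨ cong₂ _+_ (length-separatedFromZero f) (length-separatedPairs f' is-unique (f∈is ∘ fsuc)) ⟩
  n + n C 2
    ≡⟨ suc-C-2 n ⟩
  suc n C 2 ∎
  where
  open ≡-Reasoning
  f' : Fin n → ℕ
  f' = f ∘ fsuc
  a : ℕ
  a = f fzero
  row : List (Fin (suc n) × Fin (suc n))
  row = map (λ y → fzero , fsuc y) (separatedFromZero f)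
  pairsWithin : ∀ {m} → (Fin m → ℕ) → ℕ
  pairsWithin g = sum (map (λ i → fibre g i C 2) is)
  length-split : length (row ++ map (Product.map fsuc fsuc) (separatedPairs f'))
               ≡ length (separatedFromZero f) + length (separatedPairs f')
  length-split = trans (length-++ row)
    (cong₂ _+_ (length-map _ (separatedFromZero f)) (length-map _ (separatedPairs f')))
  pairsWithin-step : ∀ i → fibre f i C 2 ≡ select (fibre f') a i + fibre f' i C 2
  pairsWithin-step i = trans (cong (_C 2) (fibre-suc f i)) (insert-C-2 (a ≡ᵇ i) (fibre f' i))
  pairsWithin-split : pairsWithin f ≡ fibre f' a + pairsWithin f'
  pairsWithin-split = begin
    pairsWithin f
      ≡⟨ cong sum (map-cong pairsWithin-step is) ⟩
    sum (map (λ i → select (fibre f') a i + fibre f' i C 2) is)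
      ≡⟨ sum-map-+ (select (fibre f') a) (λ i → fibre f' i C 2) is ⟩
    sum (map (select (fibre f') a) is) + pairsWithin f'
      ≡⟨ cong (_+ pairsWithin f') (sum-select (fibre f') a is-unique (f∈is fzero)) ⟩
    fibre f' a + pairsWithin f' ∎

levels : ℕ → List ℕ
levels e = 0 ∷ map suc (upTo e)

levels-unique : ∀ e → Unique (levels e)
levels-unique e =
  All.map⁺ (universal (λ _ ()) (upTo e)) ∷ Unique.map⁺ suc-injective (Unique.upTo⁺ e)

∈-levels : ∀ {e i} → i ≤ e → i ∈ levels e
∈-levels {i = zero} _ = here refl
∈-levels {i = suc j} j<e = there (∈-map⁺ suc (∈-upTo⁺ j<e))

any-cong : ∀ {A : Set} {h h′ : A → Bool} → (∀ x → h x ≡ h′ x) → ∀ xs → any h xs ≡ any h′ xs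
any-cong h≗h′ xs = cong (foldr _∨_ false) (map-cong h≗h′ xs)

any-allFin-∘ : ∀ {n} (h : Fin n → Bool) {g : Fin n → Fin n} → Surjective _≡_ _≡_ g →
  any h (allFin n) ≡ any (h ∘ g) (allFin n)
any-allFin-∘ h {g} g-surjective = T-injective (mk⇔ to-∘ from-∘)
  where
  to-∘ : T (any h (allFin _)) → T (any (h ∘ g) (allFin _))
  to-∘ t with y , _ , hy ← find (Any.any⁻ h (allFin _) t) with x , gx≡y ← g-surjective y =
    Any.any⁺ (h ∘ g) (lose (∈-allFin x) (subst (T ∘ h) (sym (gx≡y refl)) hy))
  from-∘ : T (any (h ∘ g) (allFin _)) → T (any h (allFin _))
  from-∘ t with x , _ , hgx ← find (Any.any⁻ (h ∘ g) (allFin _) t) =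
    Any.any⁺ h (lose (∈-allFin (g x)) hgx)

T-eqF : ∀ {n} (G : Graph n) {u w} → T (eqF G u w) ⇔ u ≡ w
T-eqF G = mk⇔ (Fin.toℕ-injective ∘ ≡ᵇ⇒≡ _ _) (≡⇒≡ᵇ _ _ ∘ cong toℕ)

leastUpTo≡0 : ∀ {n} (G : Graph n) f b → leastUpTo G f (suc b) ≡ 0 ⇔ T (f 0)
leastUpTo≡0 G f b with f 0
... | true = mk⇔ _ (λ _ → refl)
... | false = mk⇔ (λ ()) (λ ())

dist≡0⇔≡ : ∀ {n} (G : Graph n) {u w} → dist G u w ≡ 0 ⇔ u ≡ w
dist≡0⇔≡ {suc n} G {u} {w} = ⇔.trans (leastUpTo≡0 G (λ k → reach G k u w) n) (T-eqF G)

module _ {n} (G : Graph n) where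
  open Graph G

  leastUpTo-cong : ∀ {f f′ : ℕ → Bool} → (∀ k → f k ≡ f′ k) → ∀ b →
    leastUpTo G f b ≡ leastUpTo G f′ b
  leastUpTo-cong f≗f′ zero = refl
  leastUpTo-cong f≗f′ (suc b) =
    cong₂ (λ c r → if c then zero else suc r) (f≗f′ 0) (leastUpTo-cong (f≗f′ ∘ suc) b)

  dist-refl : ∀ {u} → dist G u u ≡ 0
  dist-refl = from (dist≡0⇔≡ G) refl

  dist≤ecc : ∀ v x → dist G v x ≤ ecc G v
  dist≤ecc v x =
    foldr-preservesᵒ {P = dist G v x ≤_} {f = _⊔_} (λ a b → [ m≤n⇒m≤n⊔o b , m≤n⇒m≤o⊔n a ]) 0 _
      (inj₂ (Any.map⁺ (lose (∈-allFin x) (≤-refl {dist G v x}))))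

  module _ {g} (g-aut : IsAut G g) where

    reach-aut : ∀ k u w → reach G k (g u) (g w) ≡ reach G k u w
    reach-aut zero u w =
      T-injective (⇔.trans (T-eqF G) (⇔.trans (mk⇔ g-injective (cong g)) (⇔.sym (T-eqF G))))
      where g-injective = proj₁ (proj₁ g-aut)
    reach-aut (suc k) u w = cong₂ _∨_ (reach-aut k u w) (begin
      any (λ x → adj (g u) x ∧ reach G k x (g w)) (allFin n)
        ≡⟨ any-allFin-∘ _ (proj₂ (proj₁ g-aut)) ⟩
      any (λ x → adj (g u) (g x) ∧ reach G k (g x) (g w)) (allFin n)
        ≡⟨ any-cong (λ x → cong₂ _∧_ (proj₂ g-aut u x) (reach-aut k x w)) (allFin n) ⟩
      any (λ x → adj u x ∧ reach G k x w) (allFin n) ∎)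
      where open ≡-Reasoning

    dist-aut : ∀ u w → dist G (g u) (g w) ≡ dist G u w
    dist-aut u w = leastUpTo-cong (λ k → reach-aut k u w) n

  fibre-dist-zero-≤1 : ∀ v → fibre (dist G v) 0 ≤ 1
  fibre-dist-zero-≤1 v =
    fibre-≤1 (λ x≡0 y≡0 → trans (sym (to (dist≡0⇔≡ G) x≡0)) (to (dist≡0⇔≡ G) y≡0))

module _ {n} (G : Graph n) (G-dt : DistanceTransitive G) (v : Fin n) where

  DAdj⇔Separated : ∀ p → DAdj G v p ⇔ Separated (dist G v) p
  DAdj⇔Separated (x , y) =
    mk⇔ (Product.map₂ unstabilised) (λ (x<y , vx≢vy) → x<y , similar , vx≢vy ∘ dist-fixed)
    where
    unstabilised : Similar G x y × ¬ (∃ λ g → IsAut G g × g v ≡ v × g x ≡ y) →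
      dist G v x ≢ dist G v y
    unstabilised (_ , no-g) vx≡vy = no-g (G-dt v x v y vx≡vy)
    similar : Similar G x y
    similar with g , g-aut , _ , gx≡y ← G-dt x x y y (trans (dist-refl G) (sym (dist-refl G))) =
      g , g-aut , gx≡y
    dist-fixed : (∃ λ g → IsAut G g × g v ≡ v × g x ≡ y) → dist G v x ≡ dist G v y
    dist-fixed (g , g-aut , gv≡v , gx≡y) =
      trans (sym (dist-aut G g-aut v x)) (cong₂ (dist G) gv≡v gx≡y)

proposition9 : (n : ℕ) (G : Graph n) → Connected G → NontrivialAut G →
    DistanceTransitive G → (k : ℕ) → KFixed G k → (v : Fin n) →
    Card (DAdj G v)
      ((n C 2) ∸ sum (map (λ i → psiSize G v i C 2) (map suc (upTo (ecc G v)))))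
proposition9 n G _ _ G-dt _ _ v =
  separatedPairs f ,
  separatedPairs-unique f ,
  (λ p → ⇔.trans (∈-separatedPairs f) (⇔.sym (DAdj⇔Separated G G-dt v p))) ,
  (begin
    length (separatedPairs f)                    ≡⟨ m+n∸n≡m _ within ⟨
    length (separatedPairs f) + within ∸ within  ≡⟨ cong (_∸ within) pairs+within ⟩
    n C 2 ∸ within                               ∎)
  where
  open ≡-Reasoning
  f : Fin n → ℕ
  f = dist G v
  e : ℕ
  e = ecc G v
  -- psiSize G v i unfolds to fibre f i.
  within : ℕ
  within = sum (map (λ i → fibre f i C 2) (map suc (upTo e)))
  pairs+within : length (separatedPairs f) + within ≡ n C 2
  pairs+within = begin
    length (separatedPairs f) + within
      ≡⟨ cong (λ c → length (separatedPairs f) + (c + within)) (≤1⇒C-2≡0 (fibre-dist-zero-≤1 G v)) ⟨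
    length (separatedPairs f) + (fibre f 0 C 2 + within)
      ≡⟨ length-separatedPairs f (levels-unique e) (∈-levels ∘ dist≤ecc G v) ⟩
    n C 2 ∎
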